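{- Let $n$ be a positive integer and let $\mathbf{F}=(F_1,\ldots,F_d)$ be a vector of graphs, each with exactly $n$ vertices. If $n''\ge n'\ge n$ are integers, then for every positive integer $k$, \[E_{P^L_{\mathbf{F};n''}}\!\left(\binom{n'}{n}k\right)\le E_{P^L_{\mathbf{F};n'}}\!\left(\binom{n''}{n}k\right).\]
   Context: All graphs are finite simple graphs. For graphs $F,G$, $t^L(F,G)$ is the number of subgraphs of $G$ (not necessarily induced) isomorphic to $F$. For $\mathbf{F}=(F_1,\ldots,F_d)$, $t^L(\mathbf{F},G)=(t^L(F_1,G),\ldots,t^L(F_d,G))$ and $P^L_{\mathbf{F};n}=\mathrm{conv}\{t^L(\mathbf{F},G)\mid G\text{ a graph on } n\text{ vertices}\}$, a lattice polytope in $\mathbb{R}^d$. For a lattice polytope $P$ and positive integer $k$, $E_P(k)$ (the Ehrhart polynomial) is the number of points of $\mathbb{Z}^d$ in $kP=\{kp\mid p\in P\}$. -}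

module Defs where

open import Data.Nat using (ℕ; zero; suc)
open import Data.Integer using (ℤ; +_)
open import Data.Rational using (ℚ; _/_; _+_; _*_; _≤_; 0ℚ; 1ℚ)
open import Data.Bool using (Bool; true; false)
open import Data.Fin using (Fin)
open import Data.Vec using (Vec; lookup; foldr; zipWith)
open import Data.List using (List; length)
open import Data.List.Membership.Propositional using (_∈_)
open import Data.List.Relation.Unary.Unique.Propositional using (Unique)
open import Data.Product using (Σ; ∃; _×_)
open import Function.Definitions using (Injective)
open import Relation.Binary.PropositionalEquality using (_≡_)

Adj : ℕ → Set
Adj m = Vec (Vec Bool m) m

_⟨_,_⟩ : ∀ {m} → Adj m → Fin m → Fin m → Bool
A ⟨ i , j ⟩ = lookup (lookup A i) j

record Graph (m : ℕ) : Set where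
  field
    adj  : Adj m
    symm : ∀ i j → adj ⟨ i , j ⟩ ≡ adj ⟨ j , i ⟩
    irr  : ∀ i → adj ⟨ i , i ⟩ ≡ false
open Graph public

-- A (not necessarily induced) subgraph of G: a vertex set V (characteristic vector)
-- and an edge set E (symmetric adjacency matrix) with E ⊆ E(G) and every edge of E
-- having both endpoints in V.
IsSubgraph : ∀ {m} → Graph m → Vec Bool m × Adj m → Set
IsSubgraph G (V Data.Product., E) =
  (∀ u v → E ⟨ u , v ⟩ ≡ E ⟨ v , u ⟩) ×
  (∀ u v → E ⟨ u , v ⟩ ≡ true →
     (adj G ⟨ u , v ⟩ ≡ true) × (lookup V u ≡ true) × (lookup V v ≡ true))

IsoToSub : ∀ {n m} → Graph n → Vec Bool m × Adj m → Set
IsoToSub {n} {m} F (V Data.Product., E) =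
  Σ (Fin n → Fin m) λ f →
    Injective _≡_ _≡_ f ×
    (∀ v → lookup V v ≡ true → ∃ λ i → f i ≡ v) ×
    (∀ i → lookup V (f i) ≡ true) ×
    (∀ i j → adj F ⟨ i , j ⟩ ≡ E ⟨ f i , f j ⟩)

HasCard : {A : Set} → (A → Set) → ℕ → Set
HasCard {A} P c =
  Σ (List A) λ xs → Unique xs × (∀ x → x ∈ xs → P x) × (∀ x → P x → x ∈ xs)
    × length xs ≡ c

tL : ∀ {n m} → Graph n → Graph m → ℕ → Set
tL F G c = HasCard (λ H → IsSubgraph G H × IsoToSub F H) c

tLVec : ∀ {n m d} → Vec (Graph n) d → Graph m → Vec ℕ d → Set
tLVec Fs G cs = ∀ i → tL (lookup Fs i) G (lookup cs i)

InPointSet : ∀ {n d} → Vec (Graph n) d → (m : ℕ) → Vec ℕ d → Set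
InPointSet Fs m p = Σ (Graph m) λ G → tLVec Fs G p

ℕtoℚ : ℕ → ℚ
ℕtoℚ k = (+ k) / 1

ℤtoℚ : ℤ → ℚ
ℤtoℚ z = z / 1

sumℚ : ∀ {r} → Vec ℚ r → ℚ
sumℚ = foldr _ _+_ 0ℚ

InPolytope : ∀ {n d} → Vec (Graph n) d → (m : ℕ) → Vec ℚ d → Set
InPolytope {d = d} Fs m q =
  Σ ℕ λ r → Σ (Vec (Vec ℕ d) r) λ pts → Σ (Vec ℚ r) λ w →
    (∀ j → InPointSet Fs m (lookup pts j)) ×
    (∀ j → 0ℚ ≤ lookup w j) ×
    (sumℚ w ≡ 1ℚ) ×
    (∀ i → lookup q i ≡ sumℚ (zipWith _*_ w (Data.Vec.map (λ p → ℕtoℚ (lookup p i)) pts)))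

InDilate : ∀ {n d} → Vec (Graph n) d → (m k : ℕ) → Vec ℤ d → Set
InDilate {d = d} Fs m k z =
  Σ (Vec ℚ d) λ q → InPolytope Fs m q × (∀ i → ℤtoℚ (lookup z i) ≡ ℕtoℚ k * lookup q i)

Ehrhart : ∀ {n d} → Vec (Graph n) d → (m k e : ℕ) → Set
Ehrhart Fs m k e = HasCard (InDilate Fs m k) e

-- For a graph G on m + 1 vertices, each copy of F (on n vertices) survives the deletion of exactly
-- the m + 1 − n vertices outside it, so Σ_v t(F, G − v) = (m + 1 − n) t(F, G). Iterating over all
-- deletion sequences that take G from n'' down to n' vertices expresses t(𝐅, G) as a positive multiple
-- of an average of points t(𝐅, G − S) of P_{𝐅;n'}; the multiple is C(n'',n)/C(n',n). Hence
-- C(n',n)·P_{𝐅;n''} ⊆ C(n'',n)·P_{𝐅;n'}, so the lattice points of the k-th dilate of the former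
-- are among those of the latter, which is the inequality.
module Submission where

open import Defs

open import Algebra.Bundles using (CommutativeMonoid)
import Algebra.Properties.CommutativeSemigroup as CommutativeSemigroupProperties
open import Data.Bool using (Bool; true; false; if_then_else_)
import Data.Bool as Bool
open import Data.Empty using (⊥-elim)
open import Data.Fin as Fin using (Fin; punchIn; punchOut)
import Data.Fin.Properties as Finₚ
import Data.Integer as ℤ
open import Data.Integer.GCD using (gcd)
import Data.Integer.Properties as ℤₚ
import Data.Integer.Tactic.RingSolver as ℤ-Solver
open import Data.List as List using (List; []; _∷_; length; map; filter; tabulate; allFin; concat; _++_)
import Data.List.Properties as Listₚ
open import Data.List.Membership.Propositional using (_∈_)
import Data.List.Membership.Propositional.Properties as ∈ₚ
open import Data.List.Relation.Binary.Subset.Propositional using (_⊆_)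
open import Data.List.Relation.Unary.All as All using (All; []; _∷_)
import Data.List.Relation.Unary.All.Properties as Allₚ
open import Data.List.Relation.Unary.AllPairs using ([]; _∷_)
open import Data.List.Relation.Unary.Any using (here; there)
open import Data.List.Relation.Unary.Unique.Propositional using (Unique)
import Data.List.Relation.Unary.Unique.Propositional.Properties as Uniqueₚ
open import Data.Nat as ℕ using (ℕ; zero; suc; _+_; _*_; _∸_; _≤_; z≤n; s≤s)
open import Data.Nat.Combinatorics using (_C_; k>n⇒nCk≡0; nCk+nC[k+1]≡[n+1]C[k+1])
open import Data.Nat.ListAction using (sum)
import Data.Nat.ListAction.Properties as Sumₚ
import Data.Nat.Properties as ℕₚ
open import Data.Product using (Σ; ∃; _×_; _,_; proj₁; proj₂)
open import Data.Rational as ℚ using (ℚ; 0ℚ; 1ℚ; toℚᵘ; ↥_; ↧_)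
import Data.Rational.Properties as ℚₚ
open import Data.Rational.Solver using (module +-*-Solver)
open import Data.Rational.Unnormalised as ℚᵘ using (mkℚᵘ; *≡*)
import Data.Rational.Unnormalised.Properties as ℚᵘₚ
open import Data.Sum using (inj₁; inj₂)
open import Data.Vec as Vec using (Vec; lookup; removeAt; insertAt; replicate)
import Data.Vec.Properties as Vecₚ
import Data.Vec.Relation.Unary.All.Properties as VecAllₚ
open import Function using (_∘_)
open import Relation.Binary.PropositionalEquality
open import Relation.Nullary using (Dec; does; yes; no)
open import Relation.Unary using (Decidable)

module ℕ+ = CommutativeSemigroupProperties ℕₚ.+-commutativeSemigroup
module ℕ* = CommutativeSemigroupProperties ℕₚ.*-commutativeSemigroup
module ℚ* = CommutativeSemigroupProperties (CommutativeMonoid.commutativeSemigroup ℚₚ.*-1-commutativeMonoid)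

-- Counting with lists

𝟙 : {P : Set} → Dec P → ℕ
𝟙 p = if does p then 1 else 0

𝟙[≡false]+𝟙[≡true] : ∀ b → 𝟙 (b Bool.≟ false) + 𝟙 (b Bool.≟ true) ≡ 1
𝟙[≡false]+𝟙[≡true] false = refl
𝟙[≡false]+𝟙[≡true] true  = refl

length-filter : ∀ {A : Set} {P : A → Set} (P? : Decidable P) xs →
                length (filter P? xs) ≡ sum (map (𝟙 ∘ P?) xs)
length-filter P? [] = refl
length-filter P? (x ∷ xs) with does (P? x)
... | true  = cong suc (length-filter P? xs)
... | false = length-filter P? xs

sum-tabulate-+ : ∀ {N} (f g : Fin N → ℕ) → sum (tabulate (λ v → f v + g v)) ≡ sum (tabulate f) + sum (tabulate g)
sum-tabulate-+ {zero} f g = refl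
sum-tabulate-+ {suc N} f g =
  trans (cong ((f Fin.zero + g Fin.zero) +_) (sum-tabulate-+ (f ∘ Fin.suc) (g ∘ Fin.suc)))
        (ℕ+.interchange (f Fin.zero) (g Fin.zero) _ _)

sum-tabulate-cong : ∀ {N} {f g : Fin N → ℕ} → (∀ v → f v ≡ g v) → sum (tabulate f) ≡ sum (tabulate g)
sum-tabulate-cong eq = cong sum (Listₚ.tabulate-cong eq)

sum-tabulate-const : ∀ N k → sum (tabulate {n = N} (λ _ → k)) ≡ N * k
sum-tabulate-const zero    k = refl
sum-tabulate-const (suc N) k = cong (k +_) (sum-tabulate-const N k)

sum-tabulate-sum-map : ∀ {A : Set} {N} (g : A → Fin N → ℕ) xs →
  sum (tabulate (λ v → sum (map (λ x → g x v) xs))) ≡ sum (map (λ x → sum (tabulate (g x))) xs)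
sum-tabulate-sum-map {N = N} g [] = trans (sum-tabulate-const N 0) (ℕₚ.*-zeroʳ N)
sum-tabulate-sum-map g (x ∷ xs) =
  trans (sum-tabulate-+ (g x) (λ v → sum (map (λ y → g y v) xs)))
        (cong (sum (tabulate (g x)) +_) (sum-tabulate-sum-map g xs))

sum-map-const : ∀ {A : Set} (f : A → ℕ) k xs → (∀ {x} → x ∈ xs → f x ≡ k) → sum (map f xs) ≡ length xs * k
sum-map-const f k []       eq = refl
sum-map-const f k (x ∷ xs) eq = cong₂ _+_ (eq (here refl)) (sum-map-const f k xs (eq ∘ there))

sum-tabulate-* : ∀ {N} k (f : Fin N → ℕ) → sum (tabulate (λ v → k * f v)) ≡ k * sum (tabulate f)
sum-tabulate-* {zero}  k f = sym (ℕₚ.*-zeroʳ k)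
sum-tabulate-* {suc N} k f =
  trans (cong (k * f Fin.zero +_) (sum-tabulate-* k (f ∘ Fin.suc))) (sym (ℕₚ.*-distribˡ-+ k _ _))

length-concat-tabulate : ∀ {A : Set} {N} (h : Fin N → List A) →
                         length (concat (tabulate h)) ≡ sum (tabulate (length ∘ h))
length-concat-tabulate {N = zero}  h = refl
length-concat-tabulate {N = suc N} h =
  trans (Listₚ.length-++ (h Fin.zero)) (cong (length (h Fin.zero) +_) (length-concat-tabulate (h ∘ Fin.suc)))

sum-map-concat-tabulate : ∀ {A : Set} {N} (g : A → ℕ) (h : Fin N → List A) →
                          sum (map g (concat (tabulate h))) ≡ sum (tabulate (λ v → sum (map g (h v))))
sum-map-concat-tabulate {N = zero}  g h = refl
sum-map-concat-tabulate {N = suc N} g h =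
  trans (cong sum (Listₚ.map-++ g (h Fin.zero) _))
  (trans (Sumₚ.sum-++ (map g (h Fin.zero)) _)
         (cong (sum (map g (h Fin.zero)) +_) (sum-map-concat-tabulate g (h ∘ Fin.suc))))

remove-∈ : ∀ {A : Set} {x : A} ys → x ∈ ys →
           Σ (List A) λ ys′ → length ys ≡ suc (length ys′) × (∀ {y} → y ∈ ys → y ≢ x → y ∈ ys′)
remove-∈ (y ∷ ys) (here refl) = ys , refl , λ { (here refl) y≢y → ⊥-elim (y≢y refl) ; (there y∈) _ → y∈ }
remove-∈ (y ∷ ys) (there x∈) with remove-∈ ys x∈
... | ys′ , eq , keep = y ∷ ys′ , cong suc eq , λ { (here refl) _ → here refl ; (there z∈) z≢x → there (keep z∈ z≢x) }

Unique-length-≤ : ∀ {A : Set} {xs ys : List A} → Unique xs → xs ⊆ ys → length xs ≤ length ys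
Unique-length-≤ {xs = []} _ _ = z≤n
Unique-length-≤ {xs = x ∷ xs} {ys} (x∉xs ∷ unique) xs⊆ys with remove-∈ ys (xs⊆ys (here refl))
... | ys′ , eq , keep = subst (suc (length xs) ≤_) (sym eq)
  (s≤s (Unique-length-≤ unique (λ y∈ → keep (xs⊆ys (there y∈)) (λ y≡x → All.lookup x∉xs y∈ (sym y≡x)))))

Unique-length-≡ : ∀ {A : Set} {xs ys : List A} → Unique xs → Unique ys → xs ⊆ ys → ys ⊆ xs → length xs ≡ length ys
Unique-length-≡ uxs uys xs⊆ys ys⊆xs = ℕₚ.≤-antisym (Unique-length-≤ uxs xs⊆ys) (Unique-length-≤ uys ys⊆xs)

Unique-map⁺-on : ∀ {A B : Set} {Q : A → Set} (f : A → B) {xs} → All Q xs →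
                 (∀ {x y} → Q x → Q y → f x ≡ f y → x ≡ y) → Unique xs → Unique (map f xs)
Unique-map⁺-on f [] inj [] = []
Unique-map⁺-on f (qx ∷ qxs) inj (x∉xs ∷ unique) =
  Allₚ.map⁺ (All.zipWith (λ (qy , x≢y) fx≡fy → x≢y (inj qx qy fx≡fy)) (qxs , x∉xs))
  ∷ Unique-map⁺-on f qxs inj unique

-- Binomial coefficients

[1+k]*[1+n]C[1+k]≡[1+n]*nCk : ∀ n k → suc k * (suc n C suc k) ≡ suc n * (n C k)
[1+k]*[1+n]C[1+k]≡[1+n]*nCk zero zero    = refl
[1+k]*[1+n]C[1+k]≡[1+n]*nCk zero (suc k) =
  trans (cong (suc (suc k) *_) (k>n⇒nCk≡0 {1} {suc (suc k)} (s≤s (s≤s z≤n))))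
        (trans (ℕₚ.*-zeroʳ (suc (suc k))) (cong (1 *_) (sym (k>n⇒nCk≡0 {0} {suc k} (s≤s z≤n)))))
[1+k]*[1+n]C[1+k]≡[1+n]*nCk (suc n) k = begin
  suc k * (suc (suc n) C suc k)                  ≡⟨ cong (suc k *_) (nCk+nC[k+1]≡[n+1]C[k+1] (suc n) k) ⟨
  suc k * (suc n C k + suc n C suc k)            ≡⟨ ℕₚ.*-distribˡ-+ (suc k) (suc n C k) (suc n C suc k) ⟩
  suc k * (suc n C k) + suc k * (suc n C suc k)  ≡⟨ cong (suc k * (suc n C k) +_) ([1+k]*[1+n]C[1+k]≡[1+n]*nCk n k) ⟩
  suc k * (suc n C k) + suc n * (n C k)          ≡⟨ ℕₚ.+-assoc (suc n C k) (k * (suc n C k)) (suc n * (n C k)) ⟩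
  suc n C k + (k * (suc n C k) + suc n * (n C k)) ≡⟨ cong (suc n C k +_) (lower k) ⟩
  suc (suc n) * (suc n C k)                      ∎
  where
  open ≡-Reasoning
  lower : ∀ k → k * (suc n C k) + suc n * (n C k) ≡ suc n * (suc n C k)
  lower zero    = refl
  lower (suc k) =
    trans (cong (_+ suc n * (n C suc k)) ([1+k]*[1+n]C[1+k]≡[1+n]*nCk n k))
    (trans (sym (ℕₚ.*-distribˡ-+ (suc n) (n C k) (n C suc k)))
           (cong (suc n *_) (nCk+nC[k+1]≡[n+1]C[k+1] n k)))

[1+n]Ck*[1+n∸k]≡[1+n]*nCk : ∀ n k → (suc n C k) * (suc n ∸ k) ≡ suc n * (n C k)
[1+n]Ck*[1+n∸k]≡[1+n]*nCk n zero = ℕₚ.*-comm 1 (suc n)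
[1+n]Ck*[1+n∸k]≡[1+n]*nCk n (suc k) with ℕₚ.≤-<-connex k n
... | inj₂ n<k = trans (cong (_* (n ∸ k)) (k>n⇒nCk≡0 (s≤s n<k)))
  (sym (trans (cong (suc n *_) (k>n⇒nCk≡0 (ℕₚ.m<n⇒m<1+n n<k))) (ℕₚ.*-zeroʳ (suc n))))
... | inj₁ k≤n = ℕₚ.+-cancelʳ-≡ (suc n * (n C k)) _ _ (begin
  (suc n C suc k) * (n ∸ k) + suc n * (n C k)           ≡⟨ cong ((suc n C suc k) * (n ∸ k) +_) ([1+k]*[1+n]C[1+k]≡[1+n]*nCk n k) ⟨
  (suc n C suc k) * (n ∸ k) + suc k * (suc n C suc k)   ≡⟨ cong ((suc n C suc k) * (n ∸ k) +_) (ℕₚ.*-comm (suc k) _) ⟩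
  (suc n C suc k) * (n ∸ k) + (suc n C suc k) * suc k   ≡⟨ ℕₚ.*-distribˡ-+ (suc n C suc k) (n ∸ k) (suc k) ⟨
  (suc n C suc k) * (n ∸ k + suc k)                     ≡⟨ cong ((suc n C suc k) *_) n∸k+[1+k]≡1+n ⟩
  (suc n C suc k) * suc n                               ≡⟨ ℕₚ.*-comm (suc n C suc k) (suc n) ⟩
  suc n * (suc n C suc k)                               ≡⟨ cong (suc n *_) (nCk+nC[k+1]≡[n+1]C[k+1] n k) ⟨
  suc n * (n C k + n C suc k)                           ≡⟨ ℕₚ.*-distribˡ-+ (suc n) (n C k) (n C suc k) ⟩
  suc n * (n C k) + suc n * (n C suc k)                 ≡⟨ ℕₚ.+-comm (suc n * (n C k)) (suc n * (n C suc k)) ⟩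
  suc n * (n C suc k) + suc n * (n C k)                 ∎)
  where
  open ≡-Reasoning
  n∸k+[1+k]≡1+n : n ∸ k + suc k ≡ suc n
  n∸k+[1+k]≡1+n = trans (ℕₚ.+-suc (n ∸ k) k) (cong suc (ℕₚ.m∸n+n≡m k≤n))

-- Deleting t vertices one at a time from a graph on t + n′ vertices can be done in
-- deletionSequences n′ t ways, and survivals n n′ t of these avoid a fixed set of n vertices.
deletionSequences : (n′ t : ℕ) → ℕ
deletionSequences n′ zero    = 1
deletionSequences n′ (suc t) = suc (t + n′) * deletionSequences n′ t

survivals : (n n′ t : ℕ) → ℕ
survivals n n′ zero    = 1
survivals n n′ (suc t) = (suc (t + n′) ∸ n) * survivals n n′ t

deletionSequences-nonZero : ∀ n′ t → ℕ.NonZero (deletionSequences n′ t)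
deletionSequences-nonZero n′ zero    = _
deletionSequences-nonZero n′ (suc t) =
  ℕₚ.m*n≢0 (suc (t + n′)) (deletionSequences n′ t) {{_}} {{deletionSequences-nonZero n′ t}}

C*survivals≡C*deletionSequences : ∀ n n′ t → ((t + n′) C n) * survivals n n′ t ≡ (n′ C n) * deletionSequences n′ t
C*survivals≡C*deletionSequences n n′ zero    = refl
C*survivals≡C*deletionSequences n n′ (suc t) = begin
  (suc M C n) * ((suc M ∸ n) * S)  ≡⟨ ℕₚ.*-assoc (suc M C n) (suc M ∸ n) S ⟨
  (suc M C n) * (suc M ∸ n) * S    ≡⟨ cong (_* S) ([1+n]Ck*[1+n∸k]≡[1+n]*nCk M n) ⟩
  suc M * (M C n) * S              ≡⟨ ℕₚ.*-assoc (suc M) (M C n) S ⟩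
  suc M * ((M C n) * S)            ≡⟨ cong (suc M *_) (C*survivals≡C*deletionSequences n n′ t) ⟩
  suc M * ((n′ C n) * D)           ≡⟨ ℕₚ.*-assoc (suc M) (n′ C n) D ⟨
  suc M * (n′ C n) * D             ≡⟨ cong (_* D) (ℕₚ.*-comm (suc M) (n′ C n)) ⟩
  (n′ C n) * suc M * D             ≡⟨ ℕₚ.*-assoc (n′ C n) (suc M) D ⟩
  (n′ C n) * (suc M * D)           ∎
  where
  open ≡-Reasoning
  M = t + n′
  S = survivals n n′ t
  D = deletionSequences n′ t

-- Rational arithmetic

toℚᵘ-/ : ∀ i d → toℚᵘ (i ℚ./ suc d) ℚᵘ.≃ mkℚᵘ i d
toℚᵘ-/ i d = *≡* (begin
  ℚᵘ.↥ toℚᵘ p ℤ.* ℤ.+ suc d                 ≡⟨ cong (ℤ._* ℤ.+ suc d) (ℚₚ.↥ᵘ-toℚᵘ p) ⟩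
  ↥ p ℤ.* ℤ.+ suc d                        ≡⟨ cong (↥ p ℤ.*_) (ℚₚ.↧-/ i (suc d)) ⟨
  ↥ p ℤ.* (↧ p ℤ.* gcd i (ℤ.+ suc d))      ≡⟨ rearrange (↥ p) (↧ p) (gcd i (ℤ.+ suc d)) ⟩
  (↥ p ℤ.* gcd i (ℤ.+ suc d)) ℤ.* ↧ p      ≡⟨ cong (ℤ._* ↧ p) (ℚₚ.↥-/ i (suc d)) ⟩
  i ℤ.* ↧ p                                ≡⟨ cong (i ℤ.*_) (ℚₚ.↧ᵘ-toℚᵘ p) ⟨
  i ℤ.* ℚᵘ.↧ toℚᵘ p                         ∎)
  where
  open ≡-Reasoning
  p = i ℚ./ suc d
  rearrange : ∀ a b c → a ℤ.* (b ℤ.* c) ≡ (a ℤ.* c) ℤ.* b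
  rearrange = ℤ-Solver.solve-∀

ℕtoℚ-+ : ∀ a b → ℕtoℚ (a + b) ≡ ℕtoℚ a ℚ.+ ℕtoℚ b
ℕtoℚ-+ a b = ℚₚ.toℚᵘ-injective (ℚᵘₚ.≃-trans (toℚᵘ-/ (ℤ.+ (a + b)) 0) (ℚᵘₚ.≃-sym
  (ℚᵘₚ.≃-trans (ℚₚ.toℚᵘ-homo-+ (ℕtoℚ a) (ℕtoℚ b))
  (ℚᵘₚ.≃-trans (ℚᵘₚ.+-cong (toℚᵘ-/ (ℤ.+ a) 0) (toℚᵘ-/ (ℤ.+ b) 0))
               (*≡* (trans (normalise (ℤ.+ a) (ℤ.+ b)) (cong (ℤ._* ℤ.+ 1) (sym (ℤₚ.pos-+ a b)))))))))
  where
  normalise : ∀ x y → (x ℤ.* ℤ.+ 1 ℤ.+ y ℤ.* ℤ.+ 1) ℤ.* ℤ.+ 1 ≡ (x ℤ.+ y) ℤ.* (ℤ.+ 1 ℤ.* ℤ.+ 1)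
  normalise = ℤ-Solver.solve-∀

ℕtoℚ-* : ∀ a b → ℕtoℚ (a * b) ≡ ℕtoℚ a ℚ.* ℕtoℚ b
ℕtoℚ-* a b = ℚₚ.toℚᵘ-injective (ℚᵘₚ.≃-trans (toℚᵘ-/ (ℤ.+ (a * b)) 0) (ℚᵘₚ.≃-sym
  (ℚᵘₚ.≃-trans (ℚₚ.toℚᵘ-homo-* (ℕtoℚ a) (ℕtoℚ b))
  (ℚᵘₚ.≃-trans (ℚᵘₚ.*-cong (toℚᵘ-/ (ℤ.+ a) 0) (toℚᵘ-/ (ℤ.+ b) 0))
               (*≡* (trans (normalise (ℤ.+ a) (ℤ.+ b)) (cong (ℤ._* ℤ.+ 1) (sym (ℤₚ.pos-* a b)))))))))
  where
  normalise : ∀ x y → (x ℤ.* y) ℤ.* ℤ.+ 1 ≡ (x ℤ.* y) ℤ.* (ℤ.+ 1 ℤ.* ℤ.+ 1)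
  normalise = ℤ-Solver.solve-∀

ℕtoℚ-inverse : ∀ k .{{_ : ℕ.NonZero k}} → ∃ λ β → 0ℚ ℚ.≤ β × ℕtoℚ k ℚ.* β ≡ 1ℚ
ℕtoℚ-inverse k = β , ℚₚ.nonNegative⁻¹ β {{ℚₚ.pos⇒nonNeg β {{1/k>0}}}} , ℚₚ.*-inverseʳ (ℕtoℚ k) {{k≢0}}
  where
  instance
    k>0 : ℚ.Positive (ℕtoℚ k)
    k>0 = ℚₚ.normalize-pos k 1
  k≢0 = ℚₚ.pos⇒nonZero (ℕtoℚ k)
  β = (ℚ.1/ ℕtoℚ k) {{k≢0}}
  1/k>0 = ℚₚ.1/pos⇒pos (ℕtoℚ k)

*-pres-0≤ : ∀ {p q} → 0ℚ ℚ.≤ p → 0ℚ ℚ.≤ q → 0ℚ ℚ.≤ p ℚ.* q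
*-pres-0≤ {p} {q} 0≤p 0≤q =
  ℚₚ.nonNegative⁻¹ (p ℚ.* q) {{ℚₚ.nonNeg*nonNeg⇒nonNeg p {{ℚ.nonNegative 0≤p}} q {{ℚ.nonNegative 0≤q}}}}

inverse-cancel : ∀ {B β} → B ℚ.* β ≡ 1ℚ → ∀ x → β ℚ.* (B ℚ.* x) ≡ x
inverse-cancel {B} {β} Bβ≡1 x = begin
  β ℚ.* (B ℚ.* x)   ≡⟨ ℚₚ.*-assoc β B x ⟨
  β ℚ.* B ℚ.* x     ≡⟨ cong (ℚ._* x) (trans (ℚₚ.*-comm β B) Bβ≡1) ⟩
  1ℚ ℚ.* x          ≡⟨ ℚₚ.*-identityˡ x ⟩
  x                 ∎
  where open ≡-Reasoning

rescale : ∀ {A B c c′ : ℕ} .{{_ : ℕ.NonZero B}} → c′ * A ≡ c * B →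
          ∀ {x x′} → ℕtoℚ B ℚ.* x′ ≡ ℕtoℚ A ℚ.* x → ℕtoℚ c′ ℚ.* x′ ≡ ℕtoℚ c ℚ.* x
rescale {A} {B} {c} {c′} c′A≡cB {x} {x′} Bx′≡Ax = begin
  ℕtoℚ c′ ℚ.* x′                      ≡⟨ inverse-cancel {ℕtoℚ B} Bβ≡1 (ℕtoℚ c′ ℚ.* x′) ⟨
  β ℚ.* (ℕtoℚ B ℚ.* (ℕtoℚ c′ ℚ.* x′)) ≡⟨ cong (β ℚ.*_) (ℚ*.x∙yz≈y∙xz (ℕtoℚ B) (ℕtoℚ c′) x′) ⟩
  β ℚ.* (ℕtoℚ c′ ℚ.* (ℕtoℚ B ℚ.* x′)) ≡⟨ cong (λ y → β ℚ.* (ℕtoℚ c′ ℚ.* y)) Bx′≡Ax ⟩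
  β ℚ.* (ℕtoℚ c′ ℚ.* (ℕtoℚ A ℚ.* x))  ≡⟨ cong (β ℚ.*_) (ℚₚ.*-assoc (ℕtoℚ c′) (ℕtoℚ A) x) ⟨
  β ℚ.* (ℕtoℚ c′ ℚ.* ℕtoℚ A ℚ.* x)    ≡⟨ cong (λ y → β ℚ.* (y ℚ.* x)) c′A≡cBℚ ⟩
  β ℚ.* (ℕtoℚ c ℚ.* ℕtoℚ B ℚ.* x)     ≡⟨ cong (β ℚ.*_) (ℚ*.xy∙z≈y∙xz (ℕtoℚ c) (ℕtoℚ B) x) ⟩
  β ℚ.* (ℕtoℚ B ℚ.* (ℕtoℚ c ℚ.* x))   ≡⟨ inverse-cancel {ℕtoℚ B} Bβ≡1 (ℕtoℚ c ℚ.* x) ⟩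
  ℕtoℚ c ℚ.* x                        ∎
  where
  open ≡-Reasoning
  inverse = ℕtoℚ-inverse B
  β : ℚ
  β = proj₁ inverse
  Bβ≡1 : ℕtoℚ B ℚ.* β ≡ 1ℚ
  Bβ≡1 = proj₂ (proj₂ inverse)
  c′A≡cBℚ : ℕtoℚ c′ ℚ.* ℕtoℚ A ≡ ℕtoℚ c ℚ.* ℕtoℚ B
  c′A≡cBℚ = trans (sym (ℕtoℚ-* c′ A)) (trans (cong ℕtoℚ c′A≡cB) (ℕtoℚ-* c B))

∑ℚ : List ℚ → ℚ
∑ℚ = List.foldr ℚ._+_ 0ℚ

∑ℚ-++ : ∀ xs ys → ∑ℚ (xs ++ ys) ≡ ∑ℚ xs ℚ.+ ∑ℚ ys
∑ℚ-++ []       ys = sym (ℚₚ.+-identityˡ (∑ℚ ys))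
∑ℚ-++ (x ∷ xs) ys = trans (cong (x ℚ.+_) (∑ℚ-++ xs ys)) (sym (ℚₚ.+-assoc x (∑ℚ xs) (∑ℚ ys)))

∑ℚ-map-concat-tabulate : ∀ {A B : Set} {N} (g : B → ℚ) (h : Fin N → A → B) (L : Fin N → List A) →
  ∑ℚ (map g (concat (tabulate (λ j → map (h j) (L j))))) ≡ ∑ℚ (tabulate (λ j → ∑ℚ (map (g ∘ h j) (L j))))
∑ℚ-map-concat-tabulate {N = zero}  g h L = refl
∑ℚ-map-concat-tabulate {N = suc N} g h L =
  trans (cong ∑ℚ (Listₚ.map-++ g (map (h Fin.zero) (L Fin.zero)) _))
  (trans (∑ℚ-++ (map g (map (h Fin.zero) (L Fin.zero))) _)
         (cong₂ ℚ._+_ (cong ∑ℚ (sym (Listₚ.map-∘ (L Fin.zero))))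
                      (∑ℚ-map-concat-tabulate g (h ∘ Fin.suc) (L ∘ Fin.suc))))

*-distribˡ-∑ℚ-map : ∀ {A : Set} a (f : A → ℚ) xs → a ℚ.* ∑ℚ (map f xs) ≡ ∑ℚ (map (λ x → a ℚ.* f x) xs)
*-distribˡ-∑ℚ-map a f []       = ℚₚ.*-zeroʳ a
*-distribˡ-∑ℚ-map a f (x ∷ xs) =
  trans (ℚₚ.*-distribˡ-+ a (f x) (∑ℚ (map f xs))) (cong (a ℚ.* f x ℚ.+_) (*-distribˡ-∑ℚ-map a f xs))

*-distribˡ-∑ℚ-tabulate : ∀ {N} a (f : Fin N → ℚ) → a ℚ.* ∑ℚ (tabulate f) ≡ ∑ℚ (tabulate (λ j → a ℚ.* f j))
*-distribˡ-∑ℚ-tabulate {zero}  a f = ℚₚ.*-zeroʳ a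
*-distribˡ-∑ℚ-tabulate {suc N} a f =
  trans (ℚₚ.*-distribˡ-+ a (f Fin.zero) _) (cong (a ℚ.* f Fin.zero ℚ.+_) (*-distribˡ-∑ℚ-tabulate a (f ∘ Fin.suc)))

∑ℚ-tabulate-cong : ∀ {N} {f g : Fin N → ℚ} → (∀ j → f j ≡ g j) → ∑ℚ (tabulate f) ≡ ∑ℚ (tabulate g)
∑ℚ-tabulate-cong eq = cong ∑ℚ (Listₚ.tabulate-cong eq)

∑ℚ-map-const : ∀ {A : Set} a (xs : List A) → ∑ℚ (map (λ _ → a) xs) ≡ ℕtoℚ (length xs) ℚ.* a
∑ℚ-map-const a []       = sym (ℚₚ.*-zeroˡ a)
∑ℚ-map-const a (x ∷ xs) = begin
  a ℚ.+ ∑ℚ (map (λ _ → a) xs)          ≡⟨ cong₂ ℚ._+_ (sym (ℚₚ.*-identityˡ a)) (∑ℚ-map-const a xs) ⟩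
  1ℚ ℚ.* a ℚ.+ ℕtoℚ (length xs) ℚ.* a  ≡⟨ ℚₚ.*-distribʳ-+ a 1ℚ (ℕtoℚ (length xs)) ⟨
  (1ℚ ℚ.+ ℕtoℚ (length xs)) ℚ.* a      ≡⟨ cong (ℚ._* a) (ℕtoℚ-+ 1 (length xs)) ⟨
  ℕtoℚ (suc (length xs)) ℚ.* a         ∎
  where open ≡-Reasoning

∑ℚ-map-ℕtoℚ : ∀ {A : Set} (g : A → ℕ) xs → ∑ℚ (map (ℕtoℚ ∘ g) xs) ≡ ℕtoℚ (sum (map g xs))
∑ℚ-map-ℕtoℚ g []       = refl
∑ℚ-map-ℕtoℚ g (x ∷ xs) = trans (cong (ℕtoℚ (g x) ℚ.+_) (∑ℚ-map-ℕtoℚ g xs)) (sym (ℕtoℚ-+ (g x) (sum (map g xs))))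

sumℚ-map-fromList : ∀ {A : Set} (f : A → ℚ) xs → sumℚ (Vec.map f (Vec.fromList xs)) ≡ ∑ℚ (map f xs)
sumℚ-map-fromList f []       = refl
sumℚ-map-fromList f (x ∷ xs) = cong (f x ℚ.+_) (sumℚ-map-fromList f xs)

sumℚ-tabulate : ∀ {r} (w : Vec ℚ r) → sumℚ w ≡ ∑ℚ (tabulate (lookup w))
sumℚ-tabulate Vec.[]       = refl
sumℚ-tabulate (x Vec.∷ w) = cong (x ℚ.+_) (sumℚ-tabulate w)

sumℚ-zipWith-* : ∀ {A : Set} {r} (w : Vec ℚ r) (xs : Vec A r) (g : A → ℚ) →
                 sumℚ (Vec.zipWith ℚ._*_ w (Vec.map g xs)) ≡ ∑ℚ (tabulate (λ j → lookup w j ℚ.* g (lookup xs j)))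
sumℚ-zipWith-* Vec.[]      Vec.[]       g = refl
sumℚ-zipWith-* (x Vec.∷ w) (y Vec.∷ xs) g = cong (x ℚ.* g y ℚ.+_) (sumℚ-zipWith-* w xs g)

module _ (B : ℕ) (β : ℚ) (Bβ≡1 : ℕtoℚ B ℚ.* β ≡ 1ℚ) where

  ∑ℚ-share : ∀ {X : Set} w (L : List X) → length L ≡ B → ∑ℚ (map (λ _ → w ℚ.* β) L) ≡ w
  ∑ℚ-share w L |L|≡B = begin
    ∑ℚ (map (λ _ → w ℚ.* β) L)          ≡⟨ ∑ℚ-map-const (w ℚ.* β) L ⟩
    ℕtoℚ (length L) ℚ.* (w ℚ.* β)        ≡⟨ cong (λ k → ℕtoℚ k ℚ.* (w ℚ.* β)) |L|≡B ⟩
    ℕtoℚ B ℚ.* (w ℚ.* β)                 ≡⟨ cong (ℕtoℚ B ℚ.*_) (ℚₚ.*-comm w β) ⟩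
    ℕtoℚ B ℚ.* (β ℚ.* w)                 ≡⟨ ℚ*.x∙yz≈y∙xz (ℕtoℚ B) β w ⟩
    β ℚ.* (ℕtoℚ B ℚ.* w)                 ≡⟨ inverse-cancel {ℕtoℚ B} Bβ≡1 w ⟩
    w                                    ∎
    where open ≡-Reasoning

  *-∑ℚ-share : ∀ {X : Set} A p w (g : X → ℕ) L → sum (map g L) ≡ A * p →
               ℕtoℚ B ℚ.* ∑ℚ (map (λ x → (w ℚ.* β) ℚ.* ℕtoℚ (g x)) L) ≡ ℕtoℚ A ℚ.* (w ℚ.* ℕtoℚ p)
  *-∑ℚ-share A p w g L ∑g≡Ap = begin
    Bℚ ℚ.* ∑ℚ (map (λ x → (w ℚ.* β) ℚ.* ℕtoℚ (g x)) L)  ≡⟨ cong (Bℚ ℚ.*_) (*-distribˡ-∑ℚ-map (w ℚ.* β) (ℕtoℚ ∘ g) L) ⟨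
    Bℚ ℚ.* ((w ℚ.* β) ℚ.* ∑ℚ (map (ℕtoℚ ∘ g) L))        ≡⟨ cong (λ y → Bℚ ℚ.* ((w ℚ.* β) ℚ.* y)) ∑ℚg≡Ap ⟩
    Bℚ ℚ.* ((w ℚ.* β) ℚ.* (Aℚ ℚ.* pℚ))                  ≡⟨ cong (Bℚ ℚ.*_) (rearrange w β Aℚ pℚ) ⟩
    Bℚ ℚ.* (β ℚ.* (Aℚ ℚ.* (w ℚ.* pℚ)))                  ≡⟨ ℚ*.x∙yz≈y∙xz Bℚ β (Aℚ ℚ.* (w ℚ.* pℚ)) ⟩
    β ℚ.* (Bℚ ℚ.* (Aℚ ℚ.* (w ℚ.* pℚ)))                  ≡⟨ inverse-cancel {Bℚ} Bβ≡1 (Aℚ ℚ.* (w ℚ.* pℚ)) ⟩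
    Aℚ ℚ.* (w ℚ.* pℚ)                                    ∎
    where
    open ≡-Reasoning
    Aℚ = ℕtoℚ A
    Bℚ = ℕtoℚ B
    pℚ = ℕtoℚ p
    ∑ℚg≡Ap : ∑ℚ (map (ℕtoℚ ∘ g) L) ≡ Aℚ ℚ.* pℚ
    ∑ℚg≡Ap = trans (∑ℚ-map-ℕtoℚ g L) (trans (cong ℕtoℚ ∑g≡Ap) (ℕtoℚ-* A p))
    rearrange : ∀ a b c x → (a ℚ.* b) ℚ.* (c ℚ.* x) ≡ b ℚ.* (c ℚ.* (a ℚ.* x))
    rearrange = solve 4 (λ a b c x → (a :* b) :* (c :* x) := b :* (c :* (a :* x))) refl
      where open +-*-Solver

-- Deleting a vertex

data PunchInView {m : ℕ} (v : Fin (suc m)) : Fin (suc m) → Set where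
  pivot  : PunchInView v v
  other  : (i : Fin m) → PunchInView v (punchIn v i)

punchInView : ∀ {m} (v j : Fin (suc m)) → PunchInView v j
punchInView v j with v Finₚ.≟ j
... | yes refl = pivot
... | no v≢j = subst (PunchInView v) (Finₚ.punchIn-punchOut v≢j) (other (punchOut v≢j))

lookup-removeAt : ∀ {A : Set} {m} (xs : Vec A (suc m)) v i →
                  lookup (removeAt xs v) i ≡ lookup xs (punchIn v i)
lookup-removeAt xs v i =
  trans (cong (lookup (removeAt xs v)) (sym (Finₚ.punchOut-punchIn v)))
        (Vecₚ.removeAt-punchOut xs (Finₚ.punchInᵢ≢i v i ∘ sym))

Vec-ext : ∀ {A : Set} {m} {xs ys : Vec A m} → (∀ i → lookup xs i ≡ lookup ys i) → xs ≡ ys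
Vec-ext {xs = xs} {ys} eq =
  trans (sym (Vecₚ.tabulate∘lookup xs)) (trans (Vecₚ.tabulate-cong eq) (Vecₚ.tabulate∘lookup ys))

Adj-ext : ∀ {m} {A B : Adj m} → (∀ i j → A ⟨ i , j ⟩ ≡ B ⟨ i , j ⟩) → A ≡ B
Adj-ext eq = Vec-ext (λ i → Vec-ext (eq i))

false≢true : false ≢ true
false≢true ()

module _ {m : ℕ} (v : Fin (suc m)) where

  deleteAdj : Adj (suc m) → Adj m
  deleteAdj A = Vec.map (λ row → removeAt row v) (removeAt A v)

  deleteAdj-lookup : ∀ A i j → deleteAdj A ⟨ i , j ⟩ ≡ A ⟨ punchIn v i , punchIn v j ⟩
  deleteAdj-lookup A i j =
    trans (cong (λ row → lookup row j) (Vecₚ.lookup-map i (λ row → removeAt row v) (removeAt A v)))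
    (trans (lookup-removeAt (lookup (removeAt A v) i) v j)
           (cong (λ row → lookup row (punchIn v j)) (lookup-removeAt A v i)))

  insertAdj : Adj m → Adj (suc m)
  insertAdj E = insertAt (Vec.map (λ row → insertAt row v false) E) v (replicate (suc m) false)

  insertAdj-row-pivot : ∀ E j → insertAdj E ⟨ v , j ⟩ ≡ false
  insertAdj-row-pivot E j =
    trans (cong (λ row → lookup row j) (Vecₚ.insertAt-lookup (Vec.map (λ row → insertAt row v false) E) v _))
          (Vecₚ.lookup-replicate j false)

  insertAdj-row-punchIn : ∀ E i → lookup (insertAdj E) (punchIn v i) ≡ insertAt (lookup E i) v false
  insertAdj-row-punchIn E i =
    trans (Vecₚ.insertAt-punchIn (Vec.map (λ row → insertAt row v false) E) v _ i)
          (Vecₚ.lookup-map i (λ row → insertAt row v false) E)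

  insertAdj-col-pivot : ∀ E i → insertAdj E ⟨ punchIn v i , v ⟩ ≡ false
  insertAdj-col-pivot E i =
    trans (cong (λ row → lookup row v) (insertAdj-row-punchIn E i)) (Vecₚ.insertAt-lookup (lookup E i) v false)

  insertAdj-punchIn : ∀ E i j → insertAdj E ⟨ punchIn v i , punchIn v j ⟩ ≡ E ⟨ i , j ⟩
  insertAdj-punchIn E i j =
    trans (cong (λ row → lookup row (punchIn v j)) (insertAdj-row-punchIn E i))
          (Vecₚ.insertAt-punchIn (lookup E i) v false j)

  insertAdj-symmetric : ∀ E → (∀ i j → E ⟨ i , j ⟩ ≡ E ⟨ j , i ⟩) →
                        ∀ u w → insertAdj E ⟨ u , w ⟩ ≡ insertAdj E ⟨ w , u ⟩
  insertAdj-symmetric E sym-E u w = entry (punchInView v u) (punchInView v w)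
    where
    entry : ∀ {u w} → PunchInView v u → PunchInView v w → insertAdj E ⟨ u , w ⟩ ≡ insertAdj E ⟨ w , u ⟩
    entry pivot     pivot     = refl
    entry pivot     (other j) = trans (insertAdj-row-pivot E _) (sym (insertAdj-col-pivot E j))
    entry (other i) pivot     = trans (insertAdj-col-pivot E i) (sym (insertAdj-row-pivot E _))
    entry (other i) (other j) = trans (insertAdj-punchIn E i j) (trans (sym-E i j) (sym (insertAdj-punchIn E j i)))

  deleteAdj-symmetric : ∀ A → (∀ i j → A ⟨ i , j ⟩ ≡ A ⟨ j , i ⟩) →
                        ∀ i j → deleteAdj A ⟨ i , j ⟩ ≡ deleteAdj A ⟨ j , i ⟩
  deleteAdj-symmetric A sym-A i j =
    trans (deleteAdj-lookup A i j) (trans (sym-A _ _) (sym (deleteAdj-lookup A j i)))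

  deleteVertex : Graph (suc m) → Graph m
  deleteVertex G = record
    { adj  = deleteAdj (adj G)
    ; symm = deleteAdj-symmetric (adj G) (symm G)
    ; irr  = λ i → trans (deleteAdj-lookup (adj G) i i) (irr G _)
    }

Sub : ℕ → Set
Sub m = Vec Bool m × Adj m

Copy : ∀ {n m} → Graph n → Graph m → Sub m → Set
Copy F G H = IsSubgraph G H × IsoToSub F H

module _ {m : ℕ} (v : Fin (suc m)) where

  Avoids : Sub (suc m) → Set
  Avoids (V , _) = lookup V v ≡ false

  deleteSub : Sub (suc m) → Sub m
  deleteSub (V , E) = removeAt V v , deleteAdj v E

  insertSub : Sub m → Sub (suc m)
  insertSub (V , E) = insertAt V v false , insertAdj v E

  insertSub-avoids : ∀ H → Avoids (insertSub H)
  insertSub-avoids (V , E) = Vecₚ.insertAt-lookup V v false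

  deleteSub-insertSub : ∀ H → deleteSub (insertSub H) ≡ H
  deleteSub-insertSub (V , E) = cong₂ _,_ (Vecₚ.removeAt-insertAt V v false)
    (Adj-ext (λ i j → trans (deleteAdj-lookup v (insertAdj v E) i j) (insertAdj-punchIn v E i j)))

  module _ (G : Graph (suc m)) where

    avoids⇒row-pivot : ∀ H → IsSubgraph G H → Avoids H → ∀ j → proj₂ H ⟨ v , j ⟩ ≡ false
    avoids⇒row-pivot (V , E) (_ , edges) v∉V j with E ⟨ v , j ⟩ in eq
    ... | false = refl
    ... | true  = ⊥-elim (false≢true (trans (sym v∉V) (proj₁ (proj₂ (edges v j eq)))))

    insertSub-deleteSub : ∀ {H} → IsSubgraph G H → Avoids H → insertSub (deleteSub H) ≡ H
    insertSub-deleteSub {V , E} sub v∉V = cong₂ _,_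
      (trans (cong (insertAt (removeAt V v) v) (sym v∉V)) (Vecₚ.insertAt-removeAt V v))
      (Adj-ext (λ i j → entry (punchInView v i) (punchInView v j)))
      where
      entry : ∀ {i j} → PunchInView v i → PunchInView v j → insertAdj v (deleteAdj v E) ⟨ i , j ⟩ ≡ E ⟨ i , j ⟩
      entry {j = j} pivot _ = trans (insertAdj-row-pivot v (deleteAdj v E) j) (sym (avoids⇒row-pivot (V , E) sub v∉V j))
      entry (other i) pivot =
        trans (insertAdj-col-pivot v (deleteAdj v E) i) (sym (trans (proj₁ sub _ v) (avoids⇒row-pivot (V , E) sub v∉V _)))
      entry (other i) (other j) = trans (insertAdj-punchIn v (deleteAdj v E) i j) (deleteAdj-lookup v E i j)

    deleteSub-injective : ∀ {H H′} → IsSubgraph G H → Avoids H → IsSubgraph G H′ → Avoids H′ →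
                          deleteSub H ≡ deleteSub H′ → H ≡ H′
    deleteSub-injective sub v∉H sub′ v∉H′ eq =
      trans (sym (insertSub-deleteSub sub v∉H)) (trans (cong insertSub eq) (insertSub-deleteSub sub′ v∉H′))

    deleteSub-copy : ∀ {n} {F : Graph n} H → Copy F G H → Avoids H → Copy F (deleteVertex v G) (deleteSub H)
    deleteSub-copy {n} {F} (V , E) ((symE , edges) , (f , f-inj , f-onto , f-into , f-edges)) v∉V =
      (deleteAdj-symmetric v E symE , edges′) , (f′ , f′-inj , f′-onto , f′-into , f′-edges)
      where
      v≢f : ∀ i → v ≢ f i
      v≢f i v≡fi = false≢true (trans (sym v∉V) (trans (cong (lookup V) v≡fi) (f-into i)))
      f′ : Fin n → Fin m
      f′ i = punchOut (v≢f i)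
      punchIn-f′ : ∀ i → punchIn v (f′ i) ≡ f i
      punchIn-f′ i = Finₚ.punchIn-punchOut (v≢f i)
      edges′ : ∀ u w → deleteAdj v E ⟨ u , w ⟩ ≡ true →
               (deleteAdj v (adj G) ⟨ u , w ⟩ ≡ true) × (lookup (removeAt V v) u ≡ true) × (lookup (removeAt V v) w ≡ true)
      edges′ u w uw∈E with edges _ _ (trans (sym (deleteAdj-lookup v E u w)) uw∈E)
      ... | uw∈G , u∈V , w∈V = trans (deleteAdj-lookup v (adj G) u w) uw∈G ,
                               trans (lookup-removeAt V v u) u∈V , trans (lookup-removeAt V v w) w∈V
      f′-inj : ∀ {i j} → f′ i ≡ f′ j → i ≡ j
      f′-inj {i} {j} eq = f-inj (Finₚ.punchOut-injective (v≢f i) (v≢f j) eq)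
      f′-onto : ∀ u → lookup (removeAt V v) u ≡ true → ∃ λ i → f′ i ≡ u
      f′-onto u u∈V with f-onto (punchIn v u) (trans (sym (lookup-removeAt V v u)) u∈V)
      ... | i , fi≡u = i , Finₚ.punchIn-injective v _ _ (trans (punchIn-f′ i) fi≡u)
      f′-into : ∀ i → lookup (removeAt V v) (f′ i) ≡ true
      f′-into i = trans (lookup-removeAt V v (f′ i)) (trans (cong (lookup V) (punchIn-f′ i)) (f-into i))
      f′-edges : ∀ i j → adj F ⟨ i , j ⟩ ≡ deleteAdj v E ⟨ f′ i , f′ j ⟩
      f′-edges i j = trans (f-edges i j)
        (trans (sym (cong₂ (λ a b → E ⟨ a , b ⟩) (punchIn-f′ i) (punchIn-f′ j))) (sym (deleteAdj-lookup v E (f′ i) (f′ j))))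

    insertSub-copy : ∀ {n} {F : Graph n} H → Copy F (deleteVertex v G) H → Copy F G (insertSub H)
    insertSub-copy {n} {F} (V , E) ((symE , edges) , (f , f-inj , f-onto , f-into , f-edges)) =
      (insertAdj-symmetric v E symE , edges′) , (f′ , f′-inj , f′-onto , f′-into , f′-edges)
      where
      V′ = insertAt V v false
      E′ = insertAdj v E
      edges-view : ∀ {u w} → PunchInView v u → PunchInView v w → E′ ⟨ u , w ⟩ ≡ true →
                   (adj G ⟨ u , w ⟩ ≡ true) × (lookup V′ u ≡ true) × (lookup V′ w ≡ true)
      edges-view {w = w} pivot _ uw∈E = ⊥-elim (false≢true (trans (sym (insertAdj-row-pivot v E w)) uw∈E))
      edges-view (other i) pivot uw∈E = ⊥-elim (false≢true (trans (sym (insertAdj-col-pivot v E i)) uw∈E))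
      edges-view (other i) (other j) uw∈E with edges i j (trans (sym (insertAdj-punchIn v E i j)) uw∈E)
      ... | ij∈G , i∈V , j∈V = trans (sym (deleteAdj-lookup v (adj G) i j)) ij∈G ,
                               trans (Vecₚ.insertAt-punchIn V v false i) i∈V ,
                               trans (Vecₚ.insertAt-punchIn V v false j) j∈V
      edges′ : ∀ u w → E′ ⟨ u , w ⟩ ≡ true → (adj G ⟨ u , w ⟩ ≡ true) × (lookup V′ u ≡ true) × (lookup V′ w ≡ true)
      edges′ u w = edges-view (punchInView v u) (punchInView v w)
      f′ : Fin n → Fin (suc m)
      f′ i = punchIn v (f i)
      f′-inj : ∀ {i j} → f′ i ≡ f′ j → i ≡ j
      f′-inj eq = f-inj (Finₚ.punchIn-injective v _ _ eq)
      f′-onto-view : ∀ {u} → PunchInView v u → lookup V′ u ≡ true → ∃ λ i → f′ i ≡ u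
      f′-onto-view pivot v∈V′ = ⊥-elim (false≢true (trans (sym (Vecₚ.insertAt-lookup V v false)) v∈V′))
      f′-onto-view (other u) u∈V′ with f-onto u (trans (sym (Vecₚ.insertAt-punchIn V v false u)) u∈V′)
      ... | i , fi≡u = i , cong (punchIn v) fi≡u
      f′-onto : ∀ u → lookup V′ u ≡ true → ∃ λ i → f′ i ≡ u
      f′-onto u = f′-onto-view (punchInView v u)
      f′-into : ∀ i → lookup V′ (f′ i) ≡ true
      f′-into i = trans (Vecₚ.insertAt-punchIn V v false (f i)) (f-into i)
      f′-edges : ∀ i j → adj F ⟨ i , j ⟩ ≡ E′ ⟨ f′ i , f′ j ⟩
      f′-edges i j = trans (f-edges i j) (sym (insertAdj-punchIn v E (f i) (f j)))

-- Double counting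

module _ {n N : ℕ} (V : Vec Bool N) (f : Fin n → Fin N) (f-inj : ∀ {i j} → f i ≡ f j → i ≡ j)
         (f-onto : ∀ u → lookup V u ≡ true → ∃ λ i → f i ≡ u) (f-into : ∀ i → lookup V (f i) ≡ true) where

  private
    inV? : Decidable (λ u → lookup V u ≡ true)
    inV? u = lookup V u Bool.≟ true

  count-inside : sum (tabulate (λ u → 𝟙 (lookup V u Bool.≟ true))) ≡ n
  count-inside = begin
    sum (tabulate (𝟙 ∘ inV?))             ≡⟨ cong sum (Listₚ.map-tabulate (λ u → u) (𝟙 ∘ inV?)) ⟨
    sum (map (𝟙 ∘ inV?) (allFin N))       ≡⟨ length-filter inV? (allFin N) ⟨
    length (filter inV? (allFin N))       ≡⟨ Unique-length-≡ (Uniqueₚ.filter⁺ inV? (Uniqueₚ.allFin⁺ N))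
                                               (Uniqueₚ.map⁺ f-inj (Uniqueₚ.allFin⁺ n)) inside⊆image image⊆inside ⟩
    length (map f (allFin n))             ≡⟨ Listₚ.length-map f (allFin n) ⟩
    length (allFin n)                     ≡⟨ Listₚ.length-tabulate (λ i → i) ⟩
    n                                     ∎
    where
    open ≡-Reasoning
    inside⊆image : filter inV? (allFin N) ⊆ map f (allFin n)
    inside⊆image u∈ with f-onto _ (proj₂ (∈ₚ.∈-filter⁻ inV? {xs = allFin N} u∈))
    ... | i , refl = ∈ₚ.∈-map⁺ f (∈ₚ.∈-allFin i)
    image⊆inside : map f (allFin n) ⊆ filter inV? (allFin N)
    image⊆inside u∈ with ∈ₚ.∈-map⁻ f u∈
    ... | i , _ , refl = ∈ₚ.∈-filter⁺ inV? (∈ₚ.∈-allFin (f i)) (f-into i)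

  count-outside : sum (tabulate (λ u → 𝟙 (lookup V u Bool.≟ false))) ≡ N ∸ n
  count-outside = trans (sym (ℕₚ.m+n∸n≡m outside inside)) (cong₂ _∸_ total count-inside)
    where
    outside = sum (tabulate (λ u → 𝟙 (lookup V u Bool.≟ false)))
    inside  = sum (tabulate (λ u → 𝟙 (lookup V u Bool.≟ true)))
    total : outside + inside ≡ N
    total = trans (sym (sum-tabulate-+ (λ u → 𝟙 (lookup V u Bool.≟ false)) (λ u → 𝟙 (lookup V u Bool.≟ true))))
      (trans (sum-tabulate-cong (λ u → 𝟙[≡false]+𝟙[≡true] (lookup V u)))
             (trans (sum-tabulate-const N 1) (ℕₚ.*-identityʳ N)))

module _ {n m : ℕ} (F : Graph n) (G : Graph (suc m)) where

  avoids? : (v : Fin (suc m)) → Decidable (Avoids v)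
  avoids? v (V , _) = lookup V v Bool.≟ false

  copies-deleteVertex : ∀ {c} → tL F G c → Σ (Fin (suc m) → ℕ) λ c′ →
    (∀ v → tL F (deleteVertex v G) (c′ v)) × sum (tabulate c′) ≡ (suc m ∸ n) * c
  copies-deleteVertex {c} (xs , unique , sound , complete , |xs|≡c) = c′ , counts , total
    where
    survivors : Fin (suc m) → List (Sub m)
    survivors v = map (deleteSub v) (filter (avoids? v) xs)
    c′ : Fin (suc m) → ℕ
    c′ v = length (survivors v)
    counts : ∀ v → tL F (deleteVertex v G) (c′ v)
    counts v = survivors v , unique′ , sound′ , complete′ , refl
      where
      avoiding : ∀ {H} → H ∈ filter (avoids? v) xs → Copy F G H × Avoids v H
      avoiding H∈ with ∈ₚ.∈-filter⁻ (avoids? v) H∈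
      ... | H∈xs , v∉H = sound _ H∈xs , v∉H
      unique′ : Unique (survivors v)
      unique′ = Unique-map⁺-on (deleteSub v) (All.tabulate avoiding)
        (λ {H} {H′} ((sub , _) , v∉H) ((sub′ , _) , v∉H′) → deleteSub-injective v G {H} {H′} sub v∉H sub′ v∉H′)
        (Uniqueₚ.filter⁺ (avoids? v) unique)
      sound′ : ∀ H → H ∈ survivors v → Copy F (deleteVertex v G) H
      sound′ H H∈ with ∈ₚ.∈-map⁻ (deleteSub v) H∈
      ... | H₀ , H₀∈ , refl = deleteSub-copy v G {F = F} H₀ (proj₁ (avoiding H₀∈)) (proj₂ (avoiding H₀∈))
      complete′ : ∀ H → Copy F (deleteVertex v G) H → H ∈ survivors v
      complete′ H copy = subst (_∈ survivors v) (deleteSub-insertSub v H)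
        (∈ₚ.∈-map⁺ (deleteSub v) (∈ₚ.∈-filter⁺ (avoids? v)
          (complete (insertSub v H) (insertSub-copy v G {F = F} H copy)) (insertSub-avoids v H)))
    outside-copy : ∀ {H} → H ∈ xs → sum (tabulate (λ v → 𝟙 (avoids? v H))) ≡ suc m ∸ n
    outside-copy {V , _} H∈ with sound _ H∈
    ... | _ , (f , f-inj , f-onto , f-into , _) = count-outside V f f-inj f-onto f-into
    total : sum (tabulate c′) ≡ (suc m ∸ n) * c
    total = begin
      sum (tabulate c′)
        ≡⟨ sum-tabulate-cong (λ v → trans (Listₚ.length-map (deleteSub v) (filter (avoids? v) xs))
                                          (length-filter (avoids? v) xs)) ⟩
      sum (tabulate (λ v → sum (map (𝟙 ∘ avoids? v) xs)))
        ≡⟨ sum-tabulate-sum-map (λ H v → 𝟙 (avoids? v H)) xs ⟩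
      sum (map (λ H → sum (tabulate (λ v → 𝟙 (avoids? v H)))) xs)
        ≡⟨ sum-map-const _ (suc m ∸ n) xs outside-copy ⟩
      length xs * (suc m ∸ n)
        ≡⟨ cong (_* (suc m ∸ n)) |xs|≡c ⟩
      c * (suc m ∸ n)
        ≡⟨ ℕₚ.*-comm c (suc m ∸ n) ⟩
      (suc m ∸ n) * c
        ∎
      where open ≡-Reasoning

-- Averaging over deletion sequences

module _ {n d : ℕ} (Fs : Vec (Graph n) d) where

  Point : ℕ → Set
  Point m = Σ (Vec ℕ d) (InPointSet Fs m)

  points-deleteVertex : ∀ {m} (G : Graph (suc m)) p → tLVec Fs G p →
    Σ (Fin (suc m) → Vec ℕ d) λ p′ → (∀ v → tLVec Fs (deleteVertex v G) (p′ v)) ×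
      (∀ i → sum (tabulate (λ v → lookup (p′ v) i)) ≡ (suc m ∸ n) * lookup p i)
  points-deleteVertex {m} G p G↦p =
    p′ , (λ v i → subst (tL (lookup Fs i) (deleteVertex v G)) (sym (coord v i)) (proj₁ (proj₂ (step i)) v)) ,
    λ i → trans (sum-tabulate-cong (λ v → coord v i)) (proj₂ (proj₂ (step i)))
    where
    step : ∀ i → _
    step i = copies-deleteVertex (lookup Fs i) G (G↦p i)
    p′ : Fin (suc m) → Vec ℕ d
    p′ v = Vec.tabulate (λ i → proj₁ (step i) v)
    coord : ∀ v i → lookup (p′ v) i ≡ proj₁ (step i) v
    coord v i = Vecₚ.lookup∘tabulate (λ i → proj₁ (step i) v) i

  coordinate : ∀ {m} → Fin d → Point m → ℕ
  coordinate i (p , _) = lookup p i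

  -- The points t(𝐅, G − S) for all deletion sequences S of length t, with multiplicity.
  points-deleteVertices : ∀ {n′} t (G : Graph (t + n′)) p → tLVec Fs G p →
    Σ (List (Point n′)) λ ps → length ps ≡ deletionSequences n′ t ×
      (∀ i → sum (map (coordinate i) ps) ≡ survivals n n′ t * lookup p i)
  points-deleteVertices zero    G p G↦p = (p , G , G↦p) ∷ [] , refl , λ i → refl
  points-deleteVertices {n′} (suc t) G p G↦p = ps , |ps| , ∑ps
    where
    step = points-deleteVertex G p G↦p
    below : ∀ v → _
    below v = points-deleteVertices t (deleteVertex v G) (proj₁ step v) (proj₁ (proj₂ step) v)
    ps = concat (tabulate (λ v → proj₁ (below v)))
    |ps| : length ps ≡ deletionSequences n′ (suc t)
    |ps| = trans (length-concat-tabulate (λ v → proj₁ (below v)))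
      (trans (sum-tabulate-cong (λ v → proj₁ (proj₂ (below v))))
             (sum-tabulate-const (suc (t + n′)) (deletionSequences n′ t)))
    ∑ps : ∀ i → sum (map (coordinate i) ps) ≡ survivals n n′ (suc t) * lookup p i
    ∑ps i = begin
      sum (map (coordinate i) ps)
        ≡⟨ sum-map-concat-tabulate (coordinate i) (λ v → proj₁ (below v)) ⟩
      sum (tabulate (λ v → sum (map (coordinate i) (proj₁ (below v)))))
        ≡⟨ sum-tabulate-cong (λ v → proj₂ (proj₂ (below v)) i) ⟩
      sum (tabulate (λ v → survivals n n′ t * lookup (proj₁ step v) i))
        ≡⟨ sum-tabulate-* (survivals n n′ t) (λ v → lookup (proj₁ step v) i) ⟩
      survivals n n′ t * sum (tabulate (λ v → lookup (proj₁ step v) i))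
        ≡⟨ cong (survivals n n′ t *_) (proj₂ (proj₂ step) i) ⟩
      survivals n n′ t * ((suc (t + n′) ∸ n) * lookup p i)
        ≡⟨ ℕ*.x∙yz≈yx∙z (survivals n n′ t) (suc (t + n′) ∸ n) (lookup p i) ⟩
      survivals n n′ (suc t) * lookup p i
        ∎
      where open ≡-Reasoning

  Mixture : ℕ → Set
  Mixture m = List (ℚ × Point m)

  weighted : ∀ {m} → Fin d → ℚ × Point m → ℚ
  weighted i (w , x) = w ℚ.* ℕtoℚ (coordinate i x)

  barycentre : ∀ {m} → Mixture m → Vec ℚ d
  barycentre μ = Vec.tabulate (λ i → ∑ℚ (map (weighted i) μ))

  barycentre-InPolytope : ∀ {m} (μ : Mixture m) → All ((0ℚ ℚ.≤_) ∘ proj₁) μ → ∑ℚ (map proj₁ μ) ≡ 1ℚ →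
                          InPolytope Fs m (barycentre μ)
  barycentre-InPolytope {m} μ w≥0 ∑w≡1 =
    length μ , Vec.map (proj₁ ∘ proj₂) μ⃗ , Vec.map proj₁ μ⃗ ,
    (λ j → subst (InPointSet Fs m) (sym (Vecₚ.lookup-map j (proj₁ ∘ proj₂) μ⃗)) (proj₂ (proj₂ (lookup μ⃗ j)))) ,
    VecAllₚ.lookup⁺ (VecAllₚ.map⁺ {P = 0ℚ ℚ.≤_} {f = proj₁} (VecAllₚ.fromList⁺ w≥0)) ,
    trans (sumℚ-map-fromList proj₁ μ) ∑w≡1 ,
    λ i → trans (Vecₚ.lookup∘tabulate (λ i → ∑ℚ (map (weighted i) μ)) i) (sym (sumℚ-fromList-weighted i μ))
    where
    μ⃗ = Vec.fromList μ
    sumℚ-fromList-weighted : ∀ i (ν : Mixture m) →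
      sumℚ (Vec.zipWith ℚ._*_ (Vec.map proj₁ (Vec.fromList ν))
                              (Vec.map (λ p → ℕtoℚ (lookup p i)) (Vec.map (proj₁ ∘ proj₂) (Vec.fromList ν))))
        ≡ ∑ℚ (map (weighted i) ν)
    sumℚ-fromList-weighted i []      = refl
    sumℚ-fromList-weighted i (e ∷ ν) = cong (weighted i e ℚ.+_) (sumℚ-fromList-weighted i ν)

  InPolytope-deleteVertices : ∀ {n′} t {q} → InPolytope Fs (t + n′) q →
    ∃ λ q′ → InPolytope Fs n′ q′ ×
      (∀ i → ℕtoℚ (deletionSequences n′ t) ℚ.* lookup q′ i ≡ ℕtoℚ (survivals n n′ t) ℚ.* lookup q i)
  InPolytope-deleteVertices {n′} t {q} (r , pts , w , pts-valid , w≥0 , ∑w≡1 , q≡) =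
    barycentre μ , barycentre-InPolytope μ μ≥0 ∑μ≡1 , coordinates
    where
    A = survivals n n′ t
    B = deletionSequences n′ t
    inverse = ℕtoℚ-inverse B {{deletionSequences-nonZero n′ t}}
    β : ℚ
    β = proj₁ inverse
    β≥0 : 0ℚ ℚ.≤ β
    β≥0 = proj₁ (proj₂ inverse)
    Bβ≡1 : ℕtoℚ B ℚ.* β ≡ 1ℚ
    Bβ≡1 = proj₂ (proj₂ inverse)
    expansion : ∀ j → _
    expansion j = points-deleteVertices t (proj₁ (pts-valid j)) (lookup pts j) (proj₂ (pts-valid j))
    L : Fin r → List (Point n′)
    L j = proj₁ (expansion j)
    wβ : Fin r → ℚ
    wβ j = lookup w j ℚ.* β
    μ : Mixture n′
    μ = concat (tabulate (λ j → map (wβ j ,_) (L j)))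
    μ≥0 : All ((0ℚ ℚ.≤_) ∘ proj₁) μ
    μ≥0 = Allₚ.concat⁺ (Allₚ.tabulate⁺ (λ j → Allₚ.map⁺ (All.universal (λ _ → *-pres-0≤ (w≥0 j) β≥0) (L j))))
    ∑μ≡1 : ∑ℚ (map proj₁ μ) ≡ 1ℚ
    ∑μ≡1 = begin
      ∑ℚ (map proj₁ μ)                                   ≡⟨ ∑ℚ-map-concat-tabulate proj₁ (λ j → wβ j ,_) L ⟩
      ∑ℚ (tabulate (λ j → ∑ℚ (map (λ _ → wβ j) (L j))))  ≡⟨ ∑ℚ-tabulate-cong (λ j →
                                                               ∑ℚ-share B β Bβ≡1 (lookup w j) (L j) (proj₁ (proj₂ (expansion j)))) ⟩
      ∑ℚ (tabulate (lookup w))                            ≡⟨ sumℚ-tabulate w ⟨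
      sumℚ w                                              ≡⟨ ∑w≡1 ⟩
      1ℚ                                                  ∎
      where open ≡-Reasoning
    coordinates : ∀ i → ℕtoℚ B ℚ.* lookup (barycentre μ) i ≡ ℕtoℚ A ℚ.* lookup q i
    coordinates i = begin
      Bℚ ℚ.* lookup (barycentre μ) i
        ≡⟨ cong (Bℚ ℚ.*_) (Vecₚ.lookup∘tabulate (λ i → ∑ℚ (map (weighted i) μ)) i) ⟩
      Bℚ ℚ.* ∑ℚ (map (weighted i) μ)
        ≡⟨ cong (Bℚ ℚ.*_) (∑ℚ-map-concat-tabulate (weighted i) (λ j → wβ j ,_) L) ⟩
      Bℚ ℚ.* ∑ℚ (tabulate (λ j → ∑ℚ (map (weighted i ∘ (wβ j ,_)) (L j))))
        ≡⟨ *-distribˡ-∑ℚ-tabulate Bℚ (λ j → ∑ℚ (map (weighted i ∘ (wβ j ,_)) (L j))) ⟩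
      ∑ℚ (tabulate (λ j → Bℚ ℚ.* ∑ℚ (map (weighted i ∘ (wβ j ,_)) (L j))))
        ≡⟨ ∑ℚ-tabulate-cong (λ j → *-∑ℚ-share B β Bβ≡1 A (lookup (lookup pts j) i) (lookup w j)
                                     (coordinate i) (L j) (proj₂ (proj₂ (expansion j)) i)) ⟩
      ∑ℚ (tabulate (λ j → Aℚ ℚ.* (lookup w j ℚ.* p j)))
        ≡⟨ *-distribˡ-∑ℚ-tabulate Aℚ (λ j → lookup w j ℚ.* p j) ⟨
      Aℚ ℚ.* ∑ℚ (tabulate (λ j → lookup w j ℚ.* p j))
        ≡⟨ cong (Aℚ ℚ.*_) (trans (q≡ i) (sumℚ-zipWith-* w pts (λ x → ℕtoℚ (lookup x i)))) ⟨
      Aℚ ℚ.* lookup q i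
        ∎
      where
      open ≡-Reasoning
      Aℚ = ℕtoℚ A
      Bℚ = ℕtoℚ B
      p : Fin r → ℚ
      p j = ℕtoℚ (lookup (lookup pts j) i)

  InDilate-deleteVertices : ∀ {n′} t {c c′} → c′ * survivals n n′ t ≡ c * deletionSequences n′ t →
                            ∀ {z} → InDilate Fs (t + n′) c z → InDilate Fs n′ c′ z
  InDilate-deleteVertices {n′} t {c} {c′} c′A≡cB (q , q∈P , z≡cq) =
    q′ , q′∈P , λ i → trans (z≡cq i) (sym
      (rescale {survivals n n′ t} {deletionSequences n′ t} {c} {c′} {{deletionSequences-nonZero n′ t}}
               c′A≡cB {lookup q i} {lookup q′ i} (Bq′≡Aq i)))
    where
    shrunk = InPolytope-deleteVertices {n′} t {q} q∈P
    q′ = proj₁ shrunk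
    q′∈P = proj₁ (proj₂ shrunk)
    Bq′≡Aq = proj₂ (proj₂ shrunk)

HasCard-mono : ∀ {A : Set} {P Q : A → Set} {a b} → (∀ {x} → P x → Q x) → HasCard P a → HasCard Q b → a ≤ b
HasCard-mono P⇒Q (xs , unique , sound , _ , |xs|≡a) (ys , _ , _ , complete , |ys|≡b) =
  subst₂ _≤_ |xs|≡a |ys|≡b (Unique-length-≤ unique (λ {x} x∈xs → complete x (P⇒Q (sound x x∈xs))))

proposition2p8 : (n : ℕ) → 1 ≤ n → (d : ℕ) → (Fs : Vec (Graph n) d) →
    (n' n'' : ℕ) → n ≤ n' → n' ≤ n'' → (k : ℕ) → 1 ≤ k →
    (a b : ℕ) → Ehrhart Fs n'' ((n' C n) * k) a → Ehrhart Fs n' ((n'' C n) * k) b →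
    a ≤ b
proposition2p8 n _ d Fs n′ n″ _ n′≤n″ k _ a b =
  subst (λ N → Ehrhart Fs N ((n′ C n) * k) a → Ehrhart Fs n′ ((N C n) * k) b → a ≤ b) (ℕₚ.m∸n+n≡m n′≤n″)
    (HasCard-mono (λ {z} → InDilate-deleteVertices Fs {n′} t {(n′ C n) * k} {((t + n′) C n) * k} scaling {z}))
  where
  t = n″ ∸ n′
  scaling : ((t + n′) C n) * k * survivals n n′ t ≡ (n′ C n) * k * deletionSequences n′ t
  scaling = begin
    ((t + n′) C n) * k * survivals n n′ t  ≡⟨ ℕ*.xy∙z≈xz∙y ((t + n′) C n) k (survivals n n′ t) ⟩
    ((t + n′) C n) * survivals n n′ t * k  ≡⟨ cong (_* k) (C*survivals≡C*deletionSequences n n′ t) ⟩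
    (n′ C n) * deletionSequences n′ t * k  ≡⟨ ℕ*.xy∙z≈xz∙y (n′ C n) (deletionSequences n′ t) k ⟩
    (n′ C n) * k * deletionSequences n′ t  ∎
    where open ≡-Reasoning
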